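{- Let $G$ be a connected biconvex graph with parts $X$ and $Y$, with convex orderings $\langle x_1,\ldots,x_n\rangle$ of $X$ and $\langle y_1,\ldots,y_m\rangle$ of $Y$ as fixed in the context, and let $(K_1\cup J_1),\ldots,(K_k\cup J_k)$ be the complete bipartite decomposition of $G_p$, with $\mathrm{dw}(G)=k\geq 2$. If $d_G(x_1,a)\le 2$ for every $a\in J_1$ and $N_G(x_n)\cap V(K_k)\neq\emptyset$, then $\gamma(G)\le 2k$; otherwise $\gamma(G)\le 2k+2$.
   Context: All graphs are finite and simple. $d_G(u,v)$ is the distance in $G$; $\gamma(G)$ is the minimum size of a dominating set (a set $D$ such that every vertex outside $D$ has a neighbor in $D$). Let $G$ be connected bipartite with parts $X,Y$. An ordering of $X$ is convex if $N_G(y)$ is a set of consecutive vertices in it for every $y\in Y$ (symmetrically for $Y$); $G$ is biconvex if both $X$ and $Y$ admit convex orderings. Given convex orderings $\langle x_1,\ldots,x_n\rangle$ and $\langle y_1,\ldots,y_m\rangle$, let $x_L$ be the smallest vertex of $N(y_1)$ whose neighborhood is not properly contained in the neighborhood of any other vertex, and $x_R$ the largest vertex of $N(y_m)$ with the same property; assume $x_L\le x_R$ (reversing the ordering of $X$ if necessary). Let $X_p=\{x_i : x_L\le x_i\le x_R\}$ and $G_p=G[X_p\cup Y]$. Two orderings $\langle a_1,\ldots\rangle$, $\langle b_1,\ldots\rangle$ of the parts of a bipartite graph are strong if $a_ib_c, a_kb_a\in E$ imply $a_ib_a, a_kb_c\in E$ whenever $i\le k$, $a\le c$. The orderings are fixed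 so that: (a) $G_p$ is a connected bipartite permutation graph; (b) $\langle x_L,\ldots,x_R\rangle$ and $\langle y_1,\ldots,y_m\rangle$ form a strong ordering of $V(G_p)$; (c) for $x_1\le x_i<x_j\le x_L$ or $x_R\le x_j<x_i\le x_n$ we have $N(x_i)\subseteq N(x_j)$ (such orderings exist for every connected biconvex graph). The complete bipartite decomposition of a bipartite permutation graph $H$ with these orderings $A=\langle a_1,\ldots\rangle$ (here $X_p$) and $B=\langle b_1,\ldots\rangle$ (here $Y$) is obtained as follows: $K_1$ is the subgraph induced by $N_H(a_1)\cup N_H(b_1)$, $J_1$ is the set of isolated vertices of $H-K_1$; then repeat on $H-(K_1\cup J_1)$ with the induced orderings until the graph is empty, producing $(K_1\cup J_1),\ldots,(K_k\cup J_k)$. The decomposition width $\mathrm{dw}(G)$ is this number $k$ for $H=G_p$. -}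

module Defs where

open import Level using (0ℓ)
open import Data.Nat as ℕ using (ℕ; zero; suc; _+_; _*_)
open import Data.Fin as F using (Fin; fromℕ)
open import Data.Bool using (Bool; true; false)
open import Data.Product using (Σ; ∃; ∃-syntax; _×_; _,_)
open import Data.Sum using (_⊎_; inj₁; inj₂)
open import Data.Empty using (⊥)
open import Data.Unit using (⊤)
open import Data.List using (List; []; _∷_; length)
open import Data.List.NonEmpty as List⁺ using (List⁺)
open import Data.List.Membership.Propositional using (_∈_)
open import Relation.Nullary using (¬_)
open import Relation.Binary.PropositionalEquality using (_≡_; _≢_)

record Graph : Set₁ where
  field
    V   : Set
    Adj : V → V → Set
open Graph public

data Walk (G : Graph) : V G → V G → ℕ → Set where
  here : ∀ v → Walk G v v 0
  step : ∀ {u v w k} → Adj G u v → Walk G v w k → Walk G u w (suc k)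

Connected : Graph → Set
Connected G = ∀ u v → ∃[ k ] Walk G u v k

DistLE : (G : Graph) → V G → V G → ℕ → Set
DistLE G u v t = ∃[ k ] (k ℕ.≤ t × Walk G u v k)

Dominating : (G : Graph) → List (V G) → Set
Dominating G D = ∀ v → v ∈ D ⊎ (∃[ u ] (u ∈ D × Adj G u v))

DomNumLE : Graph → ℕ → Set
DomNumLE G t = ∃[ D ] (Dominating G D × length D ℕ.≤ t)

-- Permutation graph: there are two linear orders (injections into ℕ)
-- such that two distinct vertices are adjacent iff the orders disagree on them.
Injective : {A : Set} → (A → ℕ) → Set
Injective f = ∀ u v → f u ≡ f v → u ≡ v

IsPermutationGraph : Graph → Set
IsPermutationGraph G =
  ∃[ f ] ∃[ g ] (Injective {V G} f × Injective {V G} g ×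
    (∀ u v → u ≢ v →
       (Adj G u v → ((f u ℕ.< f v × g v ℕ.< g u) ⊎ (f v ℕ.< f u × g u ℕ.< g v))) ×
       (((f u ℕ.< f v × g v ℕ.< g u) ⊎ (f v ℕ.< f u × g u ℕ.< g v)) → Adj G u v)))

-- Bipartite graph with X = {x_1,…,x_{n+1}} ≅ Fin (suc n) and
-- Y = {y_1,…,y_{m+1}} ≅ Fin (suc m); the orderings are the index orders.

module Bip {n m : ℕ} (adj : Fin (suc n) → Fin (suc m) → Bool) where

  E : Fin (suc n) → Fin (suc m) → Set
  E i j = adj i j ≡ true

  BAdj : Fin (suc n) ⊎ Fin (suc m) → Fin (suc n) ⊎ Fin (suc m) → Set
  BAdj (inj₁ i) (inj₂ j) = E i j
  BAdj (inj₂ j) (inj₁ i) = E i j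
  BAdj (inj₁ _) (inj₁ _) = ⊥
  BAdj (inj₂ _) (inj₂ _) = ⊥

  G : Graph
  G = record { V = Fin (suc n) ⊎ Fin (suc m) ; Adj = BAdj }

  ConvexX : Set
  ConvexX = ∀ y i j k → i F.≤ j → j F.≤ k → E i y → E k y → E j y

  ConvexY : Set
  ConvexY = ∀ x i j k → i F.≤ j → j F.≤ k → E x i → E x k → E x j

  NSub : Fin (suc n) → Fin (suc n) → Set
  NSub x x' = ∀ j → E x j → E x' j

  NProperSub : Fin (suc n) → Fin (suc n) → Set
  NProperSub x x' = NSub x x' × ∃[ j ] (E x' j × adj x j ≡ false)

  Maximal : Fin (suc n) → Set
  Maximal x = ∀ x' → ¬ NProperSub x x'

  y₁ : Fin (suc m)
  y₁ = F.zero

  yₘ : Fin (suc m)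
  yₘ = fromℕ m

  x₁ : Fin (suc n)
  x₁ = F.zero

  xₙ : Fin (suc n)
  xₙ = fromℕ n

  IsXL : Fin (suc n) → Set
  IsXL L = E L y₁ × Maximal L × (∀ i → i F.< L → E i y₁ → ¬ Maximal i)

  IsXR : Fin (suc n) → Set
  IsXR R = E R yₘ × Maximal R × (∀ i → R F.< i → E i yₘ → ¬ Maximal i)

  module _ (L R : Fin (suc n)) where

    XP : Set
    XP = Σ (Fin (suc n)) (λ i → L F.≤ i × i F.≤ R)

    PAdj : XP ⊎ Fin (suc m) → XP ⊎ Fin (suc m) → Set
    PAdj (inj₁ (i , _)) (inj₂ j) = E i j
    PAdj (inj₂ j) (inj₁ (i , _)) = E i j
    PAdj (inj₁ _) (inj₁ _) = ⊥
    PAdj (inj₂ _) (inj₂ _) = ⊥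

    Gp : Graph
    Gp = record { V = XP ⊎ Fin (suc m) ; Adj = PAdj }

    StrongOrdering : Set
    StrongOrdering = ∀ i k a c → L F.≤ i → i F.≤ k → k F.≤ R → a F.≤ c →
      E i c → E k a → E i a × E k c

    NestedOutside : Set
    NestedOutside =
      (∀ i j → i F.< j → j F.≤ L → NSub i j) ×
      (∀ i j → R F.≤ j → j F.< i → NSub i j)

  record Block : Set₁ where
    field
      KA : Fin (suc n) → Set
      KB : Fin (suc m) → Set
      JA : Fin (suc n) → Set
      JB : Fin (suc m) → Set
  open Block public

  Least : {k : ℕ} → (Fin k → Set) → Fin k → Set
  Least P a = P a × (∀ i → P i → a F.≤ i)

  -- The block produced from the remaining graph with first vertices a₁, b₁:
  -- K = N_H(a₁) ∪ N_H(b₁), J = isolated vertices of H − K.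
  mkBlock : (Fin (suc n) → Set) → (Fin (suc m) → Set) →
            Fin (suc n) → Fin (suc m) → Block
  mkBlock remA remB a₁ b₁ = record
    { KA = KA' ; KB = KB'
    ; JA = λ i → remA i × ¬ KA' i × (∀ j → remB j → ¬ KB' j → adj i j ≡ false)
    ; JB = λ j → remB j × ¬ KB' j × (∀ i → remA i → ¬ KA' i → adj i j ≡ false) }
    where
      KA' : Fin (suc n) → Set
      KA' i = remA i × E i b₁
      KB' : Fin (suc m) → Set
      KB' j = remB j × E a₁ j

  data Decomp : (Fin (suc n) → Set) → (Fin (suc m) → Set) → List Block → Set₁ where
    done : ∀ {remA remB} → (∀ i → ¬ remA i) → (∀ j → ¬ remB j) → Decomp remA remB []
    step : ∀ {remA remB bs} (a₁ : Fin (suc n)) (b₁ : Fin (suc m)) →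
      Least remA a₁ → Least remB b₁ →
      Decomp (λ i → remA i × ¬ KA (mkBlock remA remB a₁ b₁) i × ¬ JA (mkBlock remA remB a₁ b₁) i)
             (λ j → remB j × ¬ KB (mkBlock remA remB a₁ b₁) j × ¬ JB (mkBlock remA remB a₁ b₁) j)
             bs →
      Decomp remA remB (mkBlock remA remB a₁ b₁ ∷ bs)

  IsDecompGp : Fin (suc n) → Fin (suc n) → List Block → Set₁
  IsDecompGp L R bs = Decomp (λ i → L F.≤ i × i F.≤ R) (λ _ → ⊤) bs

  Case1 : Block → Block → Set
  Case1 B₁ Bₖ =
    ((∀ i → JA B₁ i → DistLE G (inj₁ x₁) (inj₁ i) 2) ×
     (∀ j → JB B₁ j → DistLE G (inj₁ x₁) (inj₂ j) 2)) ×
    (∃[ j ] (E xₙ j × KB Bₖ j))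

-- Each block K_i ∪ J_i is dominated by two vertices: the last neighbour of its first
-- X-vertex a_i and the last X_p-neighbour of its first Y-vertex b_i; the strong ordering
-- makes each adjacent to the whole opposite side of the block.  The X-vertices outside X_p
-- have neighbourhoods containing N(x₁) or N(x_n), so one neighbour of x₁ and one of x_n
-- finish a dominating set of size 2k + 2.  In the first case the last neighbour of x₁
-- already dominates the X-side of K₁ ∪ J₁, and the given neighbour of x_n in K_k that of
-- the last block, which saves two vertices.
module Submission where

open import Defs
open import Level using (Level; 0ℓ)
open import Data.Nat as ℕ using (ℕ; suc; _+_; _*_; _≤_; z≤n; s≤s)
import Data.Nat.Properties as ℕ
open import Data.Fin as F using (Fin; zero; suc)
import Data.Fin.Properties as F
open import Data.Bool using (Bool; true)
open import Data.Bool.Properties using (¬-not; not-¬) renaming (_≟_ to _≟ᵇ_)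
open import Data.Product using (∃; ∃-syntax; _×_; _,_; proj₁; proj₂)
open import Data.Sum using (_⊎_; inj₁; inj₂; [_,_]′)
open import Data.Unit using (tt)
open import Data.List using (List; []; _∷_; _++_; length)
open import Data.List.NonEmpty as List⁺ using (List⁺)
import Data.List as List
open import Data.List.Membership.Propositional using (_∈_; find; lose)
open import Data.List.Membership.Propositional.Properties using (∈-++⁺ˡ; ∈-++⁺ʳ)
open import Data.List.Relation.Unary.Any using (here; there; any?)
open import Effect.Monad using (RawMonad)
open import Function using (_∘_)
open import Relation.Nullary using (¬_; Dec; yes; no; contradiction)
open import Relation.Nullary.Decidable using (decidable-stable; map′; _×-dec_)
open import Relation.Nullary.Negation using (¬¬-Monad; ¬¬-map)
open import Relation.Unary using (Pred; Decidable; _∪_; ∅; U)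
open import Relation.Binary.PropositionalEquality using (_≡_; refl; sym; trans; cong; subst)

private
  variable
    ℓ : Level
    A : Set ℓ

Greatest : ∀ {k} → Pred (Fin k) ℓ → Fin k → Set ℓ
Greatest P j = P j × (∀ i → P i → i F.≤ j)

∃⇒∃-greatest : ∀ {k} {P : Pred (Fin k) ℓ} → Decidable P → ∃ P → ∃ (Greatest P)
∃⇒∃-greatest {k = suc k} P? ∃P with F.any? (P? ∘ suc) | ∃P
... | yes ∃Psuc | _ =
  let (j , Pj , j-greatest) = ∃⇒∃-greatest (P? ∘ suc) ∃Psuc
  in suc j , Pj , λ { zero _ → z≤n ; (suc i) Pi → s≤s (j-greatest i Pi) }
... | no ¬∃Psuc | zero , P0 =
  zero , P0 , λ { zero _ → z≤n ; (suc i) Pi → contradiction (i , Pi) ¬∃Psuc }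
... | no ¬∃Psuc | suc i , Pi = contradiction (i , Pi) ¬∃Psuc

last-∷ : (x y : A) (ys : List A) → List⁺.last (x List⁺.∷ y ∷ ys) ≡ List⁺.last (y List⁺.∷ ys)
last-∷ x y ys with List.initLast ys
... | List.[] = refl
... | zs List.∷ʳ′ z = refl

≡2*⇒2+≡2*suc : ∀ {l} k → l ≡ 2 * k → 2 + l ≡ 2 * suc k
≡2*⇒2+≡2*suc k l≡2k = trans (cong (2 +_) l≡2k) (sym (ℕ.*-suc 2 k))

¬¬-split-off : {P K J : Set} → P → ¬ ¬ ((K ⊎ J) ⊎ (P × ¬ K × ¬ J))
¬¬-split-off p ¬goal =
  ¬goal (inj₂ (p , (λ k → ¬goal (inj₁ (inj₁ k))) , (λ j → ¬goal (inj₁ (inj₂ j)))))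

module _ {n m : ℕ} (adj : Fin (suc n) → Fin (suc m) → Bool) where
  open Bip adj
  open RawMonad (¬¬-Monad {0ℓ})

  Vertex : Set
  Vertex = Fin (suc n) ⊎ Fin (suc m)

  adjacent? : ∀ u v → Dec (Adj G u v)
  adjacent? (inj₁ i) (inj₂ j) = adj i j ≟ᵇ true
  adjacent? (inj₂ j) (inj₁ i) = adj i j ≟ᵇ true
  adjacent? (inj₁ _) (inj₁ _) = no λ ()
  adjacent? (inj₂ _) (inj₂ _) = no λ ()

  DominatedBy : List Vertex → Vertex → Set
  DominatedBy D v = ∃[ u ] (u ∈ D × Adj G u v)

  -- Domination by a given list is decidable, so it may be proved under ¬ ¬; this is how
  -- the blocks of the decomposition, whose vertex sets are not decidable, are handled.
  Dominates : List Vertex → Pred Vertex 0ℓ → Set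
  Dominates D S = ∀ v → S v → ¬ ¬ DominatedBy D v

  dominates⇒dominating : ∀ {D} → Dominates D U → Dominating G D
  dominates⇒dominating {D} dom v = inj₂ (decidable-stable dominatedBy? (dom v tt))
    where
      dominatedBy? : Dec (DominatedBy D v)
      dominatedBy? = map′ find (λ (_ , u∈D , uv) → lose u∈D uv) (any? (λ u → adjacent? u v) D)

  dominates-++⁺ˡ : ∀ {D S} D′ → Dominates D S → Dominates (D ++ D′) S
  dominates-++⁺ˡ D′ dom v s = ¬¬-map (λ (u , u∈D , uv) → u , ∈-++⁺ˡ u∈D , uv) (dom v s)

  dominates-++⁺ʳ : ∀ {D′ S} D → Dominates D′ S → Dominates (D ++ D′) S
  dominates-++⁺ʳ D dom v s = ¬¬-map (λ (u , u∈D′ , uv) → u , ∈-++⁺ʳ D u∈D′ , uv) (dom v s)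

  dominates-∈ : ∀ {u D S} → u ∈ D → (∀ v → S v → Adj G u v) → Dominates D S
  dominates-∈ u∈D uS v s = pure (_ , u∈D , uS v s)

  dominates-split : ∀ {D S S₁ S₂} → (∀ v → S v → ¬ ¬ (S₁ ∪ S₂) v) →
    Dominates D S₁ → Dominates D S₂ → Dominates D S
  dominates-split split dom₁ dom₂ v s = do
    s₁⊎s₂ ← split v s
    [ dom₁ v , dom₂ v ]′ s₁⊎s₂

  dominates-pair : ∀ {x y SX SY} → (∀ {j} → SY j → ¬ ¬ E x j) → (∀ {i} → SX i → ¬ ¬ E i y) →
    Dominates (inj₁ x ∷ inj₂ y ∷ []) [ SX , SY ]′
  dominates-pair x-dom y-dom (inj₁ i) s = ¬¬-map (λ e → _ , there (here refl) , e) (y-dom s)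
  dominates-pair x-dom y-dom (inj₂ j) s = ¬¬-map (λ e → _ , here refl , e) (x-dom s)

  distLE2⇒≡⊎common-neighbour : ∀ {x x′} → DistLE G (inj₁ x) (inj₁ x′) 2 →
    x ≡ x′ ⊎ ∃[ y ] (E x y × E x′ y)
  distLE2⇒≡⊎common-neighbour (0 , _ , here _) = inj₁ refl
  distLE2⇒≡⊎common-neighbour (1 , _ , step {v = inj₁ _} () _)
  distLE2⇒≡⊎common-neighbour (2 , _ , step {v = inj₂ y} xy (step {v = inj₁ _} yx′ (here _))) =
    inj₂ (y , xy , yx′)
  distLE2⇒≡⊎common-neighbour (suc (suc (suc _)) , s≤s (s≤s ()) , _)

  connected⇒neighbour : Connected G → ∀ x → ∃ (E x)
  connected⇒neighbour connG x with connG (inj₁ x) (inj₂ zero)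
  ... | _ , step {v = inj₂ j} xj _ = j , xj

  module _ (L R : Fin (suc n)) where

    Xp : Pred (Fin (suc n)) 0ℓ
    Xp i = L F.≤ i × i F.≤ R

    Remaining : Pred (Fin (suc n)) 0ℓ → Pred (Fin (suc m)) 0ℓ → Pred Vertex 0ℓ
    Remaining rA rB = [ rA , rB ]′

    InBlock : Block → Pred Vertex 0ℓ
    InBlock B = [ KA B ∪ JA B , KB B ∪ JB B ]′

    module _ (rA : Pred (Fin (suc n)) 0ℓ) (rB : Pred (Fin (suc m)) 0ℓ)
             (a : Fin (suc n)) (b : Fin (suc m)) where

      restA : Pred (Fin (suc n)) 0ℓ
      restA i = rA i × ¬ KA (mkBlock rA rB a b) i × ¬ JA (mkBlock rA rB a b) i

      restB : Pred (Fin (suc m)) 0ℓ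
      restB j = rB j × ¬ KB (mkBlock rA rB a b) j × ¬ JB (mkBlock rA rB a b) j

      remaining-split : ∀ v → Remaining rA rB v →
        ¬ ¬ (InBlock (mkBlock rA rB a b) ∪ Remaining restA restB) v
      remaining-split (inj₁ i) = ¬¬-split-off
      remaining-split (inj₂ j) = ¬¬-split-off

    record Remainder (rA : Pred (Fin (suc n)) 0ℓ) (rB : Pred (Fin (suc m)) 0ℓ) : Set where
      field
        ⊆Xp : ∀ {i} → rA i → Xp i
        neighbourˣ : ∀ {i} → rA i → ¬ ¬ (∃[ j ] (rB j × E i j))
        neighbourʸ : ∀ {j} → rB j → ¬ ¬ (∃[ i ] (rA i × E i j))
    open Remainder

    remainder-step : ∀ {rA rB} a b → Remainder rA rB → Remainder (restA rA rB a b) (restB rA rB a b)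
    remainder-step {rA} {rB} a b rem = record
      { ⊆Xp = ⊆Xp rem ∘ proj₁
      ; neighbourˣ = λ {i} (ri , ¬ki , ¬ji) none → ¬ji (ri , ¬ki , λ j rj ¬kj → ¬-not λ ij →
          none (j , (rj , ¬kj , λ (_ , _ , isolated) → not-¬ (isolated i ri ¬ki) ij) , ij))
      ; neighbourʸ = λ {j} (rj , ¬kj , ¬jj) none → ¬jj (rj , ¬kj , λ i ri ¬ki → ¬-not λ ij →
          none (i , (ri , ¬ki , λ (_ , _ , isolated) → not-¬ (isolated j rj ¬kj) ij) , ij))
      }

    nested-left : NestedOutside L R → ∀ {x y} → E x₁ y → x F.≤ L → E x y
    nested-left nest {zero} x₁y _ = x₁y
    nested-left nest {suc x} x₁y x≤L = proj₁ nest zero (suc x) (s≤s z≤n) x≤L _ x₁y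

    nested-right : NestedOutside L R → ∀ {x y} → E xₙ y → R F.< x → E x y
    nested-right nest {x} xₙy R<x with x F.≟ xₙ
    ... | yes refl = xₙy
    ... | no x≢xₙ = proj₂ nest xₙ x (ℕ.<⇒≤ R<x) (F.≤∧≢⇒< (F.≤fromℕ x) x≢xₙ) _ xₙy

    LeftOf RightOf : Pred Vertex 0ℓ
    LeftOf = [ F._< L , ∅ ]′
    RightOf = [ R F.<_ , ∅ ]′

    dominating-by-region : ∀ {D} → Dominates D LeftOf → Dominates D (Remaining Xp U) →
      Dominates D RightOf → Dominating G D
    dominating-by-region left inside right = dominates⇒dominating
      (dominates-split (λ v _ → pure (region v)) left (dominates-split (λ _ → pure) inside right))
      where
        region : ∀ v → (LeftOf ∪ Remaining Xp U ∪ RightOf) v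
        region (inj₂ _) = inj₂ (inj₁ tt)
        region (inj₁ x) with x F.<? L | R F.<? x
        ... | yes x<L | _ = inj₁ x<L
        ... | no x≮L | yes R<x = inj₂ (inj₂ R<x)
        ... | no x≮L | no R≮x = inj₂ (inj₁ (ℕ.≮⇒≥ x≮L , ℕ.≮⇒≥ R≮x))

    left-dominated : NestedOutside L R → ∀ {y} → E x₁ y → ∀ v → LeftOf v → Adj G (inj₂ y) v
    left-dominated nest x₁y (inj₁ x) x<L = nested-left nest x₁y (ℕ.<⇒≤ x<L)

    right-dominated : NestedOutside L R → ∀ {y} → E xₙ y → ∀ v → RightOf v → Adj G (inj₂ y) v
    right-dominated nest xₙy (inj₁ x) R<x = nested-right nest xₙy R<x

    Xp-neighbour : L F.≤ R → Connected (Gp L R) → ∀ j → ∃[ i ] (Xp i × E i j)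
    Xp-neighbour L≤R connGp j with connGp (inj₂ j) (inj₁ (L , F.≤-refl , L≤R))
    ... | _ , step {v = inj₁ (i , xp)} ij _ = i , xp , ij

    initial-remainder : L F.≤ R → Connected (Gp L R) → Remainder Xp U
    initial-remainder L≤R connGp = record
      { ⊆Xp = λ xp → xp
      ; neighbourˣ = λ xp → pure (neighbour xp)
      ; neighbourʸ = λ _ → pure (Xp-neighbour L≤R connGp _)
      }
      where
        neighbour : ∀ {i} → Xp i → ∃[ j ] (U j × E i j)
        neighbour xp with connGp (inj₁ (_ , xp)) (inj₂ zero)
        ... | _ , step {v = inj₂ j} ij _ = j , tt , ij

    module _ (strong : StrongOrdering L R) where

      block-dominatedˣ : ∀ {rA rB a b y} → Remainder rA rB → Least rA a → Least rB b →
        Greatest (E a) y → ∀ {x} → (KA (mkBlock rA rB a b) ∪ JA (mkBlock rA rB a b)) x → ¬ ¬ E x y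
      block-dominatedˣ {a = a} {b} {y} rem (ra , a-least) (_ , b-least) (ay , y-greatest)
                       {x} (inj₁ (rx , xb)) = do
        (j , rj , aj) ← neighbourˣ rem ra
        pure (proj₂ (strong a x b y (proj₁ (⊆Xp rem ra)) (a-least x rx) (proj₂ (⊆Xp rem rx))
                              (F.≤-trans (b-least j rj) (y-greatest j aj)) ay xb))
      block-dominatedˣ {a = a} {y = y} rem (ra , a-least) _ (ay , y-greatest)
                       {x} (inj₂ (rx , _ , isolated)) = do
        (j , rj , xj) ← neighbourˣ rem rx
        (_ , aj) ← λ ¬kj → not-¬ (isolated j rj ¬kj) xj
        pure (proj₂ (strong a x j y (proj₁ (⊆Xp rem ra)) (a-least x rx) (proj₂ (⊆Xp rem rx))
                              (y-greatest j aj) ay xj))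

      block-dominatedʸ : ∀ {rA rB a b x} → Remainder rA rB → Least rA a → Least rB b →
        Greatest (λ i → Xp i × E i b) x →
        ∀ {y} → (KB (mkBlock rA rB a b) ∪ JB (mkBlock rA rB a b)) y → ¬ ¬ E x y
      block-dominatedʸ {a = a} {b} {x} rem (ra , a-least) (rb , b-least) ((xp , xb) , x-greatest)
                       {y} (inj₁ (ry , ay)) = do
        (i , ri , ib) ← neighbourʸ rem rb
        pure (proj₂ (strong a x b y (proj₁ (⊆Xp rem ra))
                              (F.≤-trans (a-least i ri) (x-greatest i (⊆Xp rem ri , ib)))
                              (proj₂ xp) (b-least y ry) ay xb))
      block-dominatedʸ {b = b} {x} rem _ (_ , b-least) ((xp , xb) , x-greatest)
                       {y} (inj₂ (ry , _ , isolated)) = do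
        (i , ri , iy) ← neighbourʸ rem ry
        (_ , ib) ← λ ¬ki → not-¬ (isolated i ri ¬ki) iy
        pure (proj₂ (strong i x b y (proj₁ (⊆Xp rem ri)) (x-greatest i (⊆Xp rem ri , ib)) (proj₂ xp)
                              (b-least y ry) iy xb))

      module _ {lastX : Fin (suc m) → Fin (suc n)}
               (lastX-greatest : ∀ y → Greatest (λ i → Xp i × E i y) (lastX y))
               {lastY : Fin (suc n) → Fin (suc m)}
               (lastY-greatest : ∀ x → Greatest (E x) (lastY x)) where

        dominators : Fin (suc n) → Fin (suc m) → List Vertex
        dominators a b = inj₁ (lastX b) ∷ inj₂ (lastY a) ∷ []

        block-dominated : ∀ {rA rB a b} → Remainder rA rB → Least rA a → Least rB b →
          Dominates (dominators a b) (InBlock (mkBlock rA rB a b))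
        block-dominated rem la lb =
          dominates-pair (block-dominatedʸ rem la lb (lastX-greatest _))
                         (block-dominatedˣ rem la lb (lastY-greatest _))

        dominates-exhausted : ∀ {D rA rB} → (∀ i → ¬ rA i) → (∀ j → ¬ rB j) →
          Dominates D (Remaining rA rB)
        dominates-exhausted noA _ (inj₁ i) ri = contradiction ri (noA i)
        dominates-exhausted _ noB (inj₂ j) rj = contradiction rj (noB j)

        decomp-dominated : ∀ {rA rB bs} → Decomp rA rB bs → Remainder rA rB →
          ∃[ D ] (length D ≡ 2 * length bs × Dominates D (Remaining rA rB))
        decomp-dominated (done noA noB) _ = [] , refl , dominates-exhausted noA noB
        decomp-dominated {rA} {rB} {_ ∷ bs} (step a b la lb d) rem =
          let D , |D| , dom = decomp-dominated d (remainder-step a b rem)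
          in dominators a b ++ D , ≡2*⇒2+≡2*suc (length bs) |D| ,
             dominates-split (remaining-split rA rB a b)
               (dominates-++⁺ˡ D (block-dominated rem la lb)) (dominates-++⁺ʳ (dominators a b) dom)

        -- The X-vertices of the last block all lie between its first vertex and x_n,
        -- so by convexity a common neighbour of those two dominates them.
        decomp-dominated-but-last : ConvexX → ∀ {rA rB B bs y} → Decomp rA rB (B ∷ bs) →
          Remainder rA rB → E xₙ y → KB (List⁺.last (B List⁺.∷ bs)) y →
          ∃[ D ] (length D ≡ 2 * length (B ∷ bs) × inj₂ y ∈ D × Dominates D (Remaining rA rB))
        decomp-dominated-but-last convX {rA} {rB} {bs = []} {y}
                                  (step a b la lb (done noA noB)) rem xₙy (_ , ay) =
          inj₁ (lastX b) ∷ inj₂ y ∷ [] , refl , there (here refl) ,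
          dominates-split (remaining-split rA rB a b)
            (dominates-pair (block-dominatedʸ rem la lb (lastX-greatest b)) (pure ∘ last-block))
            (dominates-exhausted noA noB)
          where
            last-block : ∀ {x} → (KA (mkBlock rA rB a b) ∪ JA (mkBlock rA rB a b)) x → E x y
            last-block {x} s = convX y a x xₙ (proj₂ la x ([ proj₁ , proj₁ ]′ s)) (F.≤fromℕ x) ay xₙy
        decomp-dominated-but-last convX {rA} {rB} {bs = B′ ∷ bs′}
                                  (step a b la lb d) rem xₙy ky =
          let D , |D| , y∈D , dom = decomp-dominated-but-last convX d (remainder-step a b rem) xₙy
                                      (subst (λ B → KB B _) (last-∷ _ B′ bs′) ky)
          in dominators a b ++ D , ≡2*⇒2+≡2*suc (suc (length bs′)) |D| , there (there y∈D) ,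
             dominates-split (remaining-split rA rB a b)
               (dominates-++⁺ˡ D (block-dominated rem la lb)) (dominates-++⁺ʳ (dominators a b) dom)

        -- K₁ by the strong ordering; J₁ through a common neighbour with x₁, which the
        -- hypothesis d(x₁, ·) ≤ 2 provides.
        first-block-dominated : ConvexY → ∀ {a b y} → Least U b → E L y → Greatest (E x₁) y →
          (∀ i → JA (mkBlock Xp U a b) i → DistLE G (inj₁ x₁) (inj₁ i) 2) →
          ∀ {x} → (KA (mkBlock Xp U a b) ∪ JA (mkBlock Xp U a b)) x → E x y
        first-block-dominated _ {b = b} {y} (_ , b-least) Ly _ _ {x} (inj₁ (xp , xb)) =
          proj₂ (strong L x b y F.≤-refl (proj₁ xp) (proj₂ xp) (b-least y tt) Ly xb)
        first-block-dominated convY {y = y} _ Ly (x₁y , y-greatest) near {x} (inj₂ jx@(xp , _))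
          with distLE2⇒≡⊎common-neighbour (near x jx)
        ... | inj₁ refl = x₁y
        ... | inj₂ (z , x₁z , xz) with F.≤-total y (lastY x)
        ...   | inj₁ y≤last =
          convY x z y (lastY x) (y-greatest z x₁z) y≤last xz (proj₁ (lastY-greatest x))
        ...   | inj₂ last≤y =
          proj₂ (strong L x (lastY x) y F.≤-refl (proj₁ xp) (proj₂ xp) last≤y Ly (proj₁ (lastY-greatest x)))

        γ≤2k+2 : NestedOutside L R → Remainder Xp U → ∀ {bs} → Decomp Xp U bs →
          DomNumLE G (2 * length bs + 2)
        γ≤2k+2 nest rem₀ d =
          let D , |D| , dom = decomp-dominated d rem₀
          in inj₂ (lastY x₁) ∷ inj₂ (lastY xₙ) ∷ D ,
             dominating-by-region
               (dominates-∈ (here refl) (left-dominated nest (proj₁ (lastY-greatest x₁))))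
               (dominates-++⁺ʳ (inj₂ (lastY x₁) ∷ inj₂ (lastY xₙ) ∷ []) dom)
               (dominates-∈ (there (here refl)) (right-dominated nest (proj₁ (lastY-greatest xₙ)))) ,
             ℕ.≤-reflexive (trans (cong (2 +_) |D|) (ℕ.+-comm 2 _))

        γ≤2k : NestedOutside L R → ConvexX → ConvexY → Remainder Xp U →
          ∀ {B bs} → Decomp Xp U (B ∷ bs) → 2 ≤ suc (length bs) →
          Case1 B (List⁺.last (B List⁺.∷ bs)) → DomNumLE G (2 * suc (length bs))
        γ≤2k _ _ _ _ {bs = []} _ (s≤s ())
        γ≤2k nest convX convY rem₀ {bs = B′ ∷ bs′} (step a b la lb d) _ ((near , _) , j , xₙj , kj) =
          let D , |D| , j∈D , dom = decomp-dominated-but-last convX d (remainder-step a b rem₀) xₙj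
                                      (subst (λ B → KB B j) (last-∷ _ B′ bs′) kj)
              x₁y₁ = proj₁ (lastY-greatest x₁)
              first = inj₁ (lastX b) ∷ inj₂ (lastY x₁) ∷ []
          in first ++ D ,
             dominating-by-region
               (dominates-∈ (there (here refl)) (left-dominated nest x₁y₁))
               (dominates-split (remaining-split Xp U a b)
                 (dominates-++⁺ˡ D (dominates-pair (block-dominatedʸ rem₀ la lb (lastX-greatest b))
                   (pure ∘ first-block-dominated convY lb (nested-left nest x₁y₁ F.≤-refl)
                                                 (lastY-greatest x₁) near)))
                 (dominates-++⁺ʳ first dom))
               (dominates-∈ (there (there j∈D)) (right-dominated nest xₙj)) ,
             ℕ.≤-reflexive (≡2*⇒2+≡2*suc (suc (length bs′)) |D|)

lemma14 : (n m : ℕ) (adj : Fin (suc n) → Fin (suc m) → Bool) (L R : Fin (suc n)) →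
    Connected (Bip.G adj) → Bip.ConvexX adj → Bip.ConvexY adj →
    Bip.IsXL adj L → Bip.IsXR adj R → L F.≤ R →
    Connected (Bip.Gp adj L R) → IsPermutationGraph (Bip.Gp adj L R) →
    Bip.StrongOrdering adj L R → Bip.NestedOutside adj L R →
    (B : List⁺ (Bip.Block adj)) → Bip.IsDecompGp adj L R (List⁺.toList B) →
    2 ≤ List⁺.length B →
    (Bip.Case1 adj (List⁺.head B) (List⁺.last B) →
       DomNumLE (Bip.G adj) (2 * List⁺.length B)) ×
    (¬ Bip.Case1 adj (List⁺.head B) (List⁺.last B) →
       DomNumLE (Bip.G adj) (2 * List⁺.length B + 2))
-- The choice of x_L, x_R and the permutation-graph structure of G_p enter only through (b) and (c).
lemma14 n m adj L R connG convX convY _ _ L≤R connGp _ strong nest (_ List⁺.∷ _) d 2≤k =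
  γ≤2k adj L R strong (proj₂ ∘ greatestX) (proj₂ ∘ greatestY) nest convX convY rem₀ d 2≤k ,
  λ _ → γ≤2k+2 adj L R strong (proj₂ ∘ greatestX) (proj₂ ∘ greatestY) nest rem₀ d
  where
    open Bip adj using (E)
    rem₀ : Remainder adj L R (Xp adj L R) U
    rem₀ = initial-remainder adj L R L≤R connGp
    greatestY : ∀ x → ∃ (Greatest (E x))
    greatestY x = ∃⇒∃-greatest (λ j → adj x j ≟ᵇ true) (connected⇒neighbour adj connG x)
    greatestX : ∀ y → ∃ (Greatest (λ i → Xp adj L R i × E i y))
    greatestX y = ∃⇒∃-greatest (λ i → (L F.≤? i ×-dec i F.≤? R) ×-dec adj i y ≟ᵇ true)
                               (Xp-neighbour adj L R L≤R connGp y)
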